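{- In the setting described in the context, for every $k\ge1$ the number of ordered $k$-tuples $(C_1,\dots,C_k)$ of edges of $H$ for which there exist an injective weight map $\sigma:V\to[0,1)$ and a color $i$ such that $(C_1,\dots,C_k)$ is an ordered $k$-chain for color $i$ is at most $2\binom{|E|}{k}$.
   Context: Let $n$ be a sufficiently large integer and $r$ an integer with $2\le r<(\ln n)^{1/5}$. Let $H=(V,E)$ be an $n$-uniform hypergraph with $m=|V|$ vertices, $m$ divisible by $r$, $m\ge \frac{n^2(r-1)}{2\ln n}$, and $|E|\le 0.01\left(\frac{n}{\ln n}\right)^{\frac{r-1}{r}}r^{n-1}$. Colors are $1,\dots,r$. Put $p=\frac{r-1}{r}\cdot\frac{\ln(n/\ln n)}{n}$. Partition $[0,1)$ into consecutive half-open intervals, from left to right, $\Delta_1,\delta_1,\Delta_2,\delta_2,\dots,\delta_{r-1},\Delta_r$, where $\Delta_i=\left[(i-1)\left(\frac{1-p}{r}+\frac{p}{r-1}\right),\, i\frac{1-p}{r}+(i-1)\frac{p}{r-1}\right)$ has length $\frac{1-p}{r}$ and $\delta_i=[\alpha_i,\beta_i)$ with $\alpha_i=i\frac{1-p}{r}+(i-1)\frac{p}{r-1}$, $\beta_i=i\left(\frac{1-p}{r}+\frac{p}{r-1}\right)$ has length $\frac{p}{r-1}$. Given weights $\sigma(v)\in[0,1)$ of the vertices, a vertex belongs to an interval if its weight lies in it; the first (last) vertex of an edge is its vertex of minimal (maximal) weight. Algorithm 1 produces the coloring $C^0$: first, every vertex belonging to $\Delta_i$ receives color $i$; then the vertices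 belonging to $\delta_1\cup\dots\cup\delta_{r-1}$ are processed in increasing order of weight, and a vertex $v$ belonging to $\delta_i$ receives color $i$ unless at that moment there is an edge containing $v$ all of whose other vertices already have color $i$, in which case $v$ receives color $i+1$. For $1\le k\le i\le r$, a sequence $(C_1,\dots,C_k)$ of edges is an ordered $k$-chain for color $i$ if: (a) every vertex of $C_k$ has color $i$ in $C^0$; (b) for each $j=1,\dots,k-1$, the last vertex of $C_j$ coincides with the first vertex of $C_{j+1}$, this vertex belongs to $\delta_{i-k+j}$, and all other vertices of $C_j$ have color $i-k+j$ in $C^0$; (c) the first vertex of $C_1$ belongs to $\Delta_{i-k+1}$. -}

module Defs where

open import Data.Nat as ℕ using (ℕ; zero; suc; _∸_)
open import Data.Fin using (Fin; toℕ)
open import Data.Fin.Subset using (Subset; _∈_)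
open import Data.Vec using (Vec; lookup)
open import Data.Product using (Σ; ∃; ∃-syntax; _×_; _,_)
open import Data.Sum using (_⊎_)
open import Data.Empty using (⊥)
open import Relation.Nullary using (¬_)
open import Relation.Binary.PropositionalEquality using (_≡_)

-- The real numbers, axiomatised as a complete ordered field together
-- with the natural logarithm on the positive reals.
-- (A complete ordered field is unique up to isomorphism, and the axioms
--  on ln below determine it uniquely, so quantifying over all models is
--  the same as speaking about ℝ.)

record Reals : Set₁ where
  infixl 6 _+ʳ_
  infixl 7 _*ʳ_
  infix 4 _<ʳ_ _≤ʳ_
  field
    R      : Set
    0ʳ 1ʳ  : R
    _+ʳ_   : R → R → R
    _*ʳ_   : R → R → R
    -ʳ_    : R → R
    invʳ   : R → R          -- multiplicative inverse (meaningful for x ≢ 0)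
    _<ʳ_   : R → R → Set
    +-assoc   : ∀ x y z → (x +ʳ y) +ʳ z ≡ x +ʳ (y +ʳ z)
    +-comm    : ∀ x y → x +ʳ y ≡ y +ʳ x
    +-idˡ     : ∀ x → 0ʳ +ʳ x ≡ x
    +-invˡ    : ∀ x → (-ʳ x) +ʳ x ≡ 0ʳ
    *-assoc   : ∀ x y z → (x *ʳ y) *ʳ z ≡ x *ʳ (y *ʳ z)
    *-comm    : ∀ x y → x *ʳ y ≡ y *ʳ x
    *-idˡ     : ∀ x → 1ʳ *ʳ x ≡ x
    *-invˡ    : ∀ x → ¬ (x ≡ 0ʳ) → invʳ x *ʳ x ≡ 1ʳ
    distribˡ  : ∀ x y z → x *ʳ (y +ʳ z) ≡ x *ʳ y +ʳ x *ʳ z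
    0≢1       : ¬ (0ʳ ≡ 1ʳ)
    <-irrefl  : ∀ x → ¬ (x <ʳ x)
    <-trans   : ∀ {x y z} → x <ʳ y → y <ʳ z → x <ʳ z
    <-trichotomy : ∀ x y → x <ʳ y ⊎ (x ≡ y ⊎ y <ʳ x)
    +-mono-<  : ∀ {x y} z → x <ʳ y → x +ʳ z <ʳ y +ʳ z
    *-pos     : ∀ {x y} → 0ʳ <ʳ x → 0ʳ <ʳ y → 0ʳ <ʳ x *ʳ y
  _≤ʳ_ : R → R → Set
  x ≤ʳ y = x <ʳ y ⊎ x ≡ y
  field
    lub : (S : R → Set) → (∃ λ x → S x) → (∃ λ b → ∀ x → S x → x ≤ʳ b) →
          ∃ λ s → (∀ x → S x → x ≤ʳ s) × (∀ b → (∀ x → S x → x ≤ʳ b) → s ≤ʳ b)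
    ln        : R → R
    ln-mult   : ∀ {x y} → 0ʳ <ʳ x → 0ʳ <ʳ y → ln (x *ʳ y) ≡ ln x +ʳ ln y
    ln-upper  : ∀ {x} → 0ʳ <ʳ x → ln x ≤ʳ x +ʳ (-ʳ 1ʳ)
    ln-lower  : ∀ {x} → 0ʳ <ʳ x → 1ʳ +ʳ (-ʳ invʳ x) ≤ʳ ln x

module RealDefs (ℝ : Reals) where
  open Reals ℝ public

  _-ʳ_ : R → R → R
  x -ʳ y = x +ʳ (-ʳ y)

  fromℕ : ℕ → R
  fromℕ zero    = 0ʳ
  fromℕ (suc n) = 1ʳ +ʳ fromℕ n

  _^ʳ_ : R → ℕ → R
  x ^ʳ zero  = 1ʳ
  x ^ʳ suc k = x *ʳ (x ^ʳ k)

-- The setting: parameters n, r, the hypergraph H on vertex set Fin m with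
-- edges E : Fin e → Subset m (so |E| = e), and weights σ.

module Setting (ℝ : Reals) (n r : ℕ) {m e : ℕ} (E : Fin e → Subset m) where
  open RealDefs ℝ

  p : R
  p = fromℕ (r ∸ 1) *ʳ invʳ (fromℕ r) *ʳ
        ln (fromℕ n *ʳ invʳ (ln (fromℕ n))) *ʳ invʳ (fromℕ n)

  a b : R
  a = (1ʳ -ʳ p) *ʳ invʳ (fromℕ r)       -- length of Δ_i
  b = p *ʳ invʳ (fromℕ (r ∸ 1))          -- length of δ_i

  InΔ : ℕ → R → Set
  InΔ i x = (fromℕ (i ∸ 1) *ʳ (a +ʳ b) ≤ʳ x)
          × (x <ʳ fromℕ i *ʳ a +ʳ fromℕ (i ∸ 1) *ʳ b)

  Inδ : ℕ → R → Set
  Inδ i x = (fromℕ i *ʳ a +ʳ fromℕ (i ∸ 1) *ʳ b ≤ʳ x)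
          × (x <ʳ fromℕ i *ʳ (a +ʳ b))

  InSomeΔ : R → Set
  InSomeΔ x = ∃ λ i → (1 ℕ.≤ i) × (i ℕ.≤ r) × InΔ i x

  Weights : (Fin m → R) → Set
  Weights σ = (∀ v → 0ʳ ≤ʳ σ v) × (∀ v → σ v <ʳ 1ʳ)
            × (∀ u v → σ u ≡ σ v → u ≡ v)

  module _ (σ : Fin m → R) where

    IsFirst : Subset m → Fin m → Set
    IsFirst C v = v ∈ C × (∀ u → u ∈ C → σ v ≤ʳ σ u)

    IsLast : Subset m → Fin m → Set
    IsLast C v = v ∈ C × (∀ u → u ∈ C → σ u ≤ʳ σ v)

    module _ (col : Fin m → ℕ) where

      -- at the moment vertex v (in some δ) is processed, u already has a
      -- colour iff u lies in some Δ_i or u lies in some δ_j with smaller weight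
      ColouredBefore : Fin m → Fin m → Set
      ColouredBefore v u = InSomeΔ (σ u) ⊎ (σ u <ʳ σ v)

      Blocked : ℕ → Fin m → Set
      Blocked i v = ∃ λ (j : Fin e) → v ∈ E j ×
        (∀ u → u ∈ E j → ¬ (u ≡ v) → ColouredBefore v u × col u ≡ i)

      -- col is the colouring C⁰ produced by Algorithm 1
      -- (this specification has exactly one solution, by induction on weight)
      IsAlg1 : Set
      IsAlg1 = ∀ v →
          (∀ i → 1 ℕ.≤ i → i ℕ.≤ r → InΔ i (σ v) → col v ≡ i)
        × (∀ i → 1 ℕ.≤ i → i ℕ.≤ r ∸ 1 → Inδ i (σ v) →
              (Blocked i v → col v ≡ suc i) × (¬ Blocked i v → col v ≡ i))

      -- (C_1,…,C_k) (entry j : Fin k is C_{toℕ j + 1}) is an ordered k-chain for colour i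
      IsChain : (k i : ℕ) → Vec (Fin e) k → Set
      IsChain k i C =
          (∀ (j : Fin k) → suc (toℕ j) ≡ k → ∀ u → u ∈ E (lookup C j) → col u ≡ i)
        × (∀ (j j' : Fin k) → suc (toℕ j) ≡ toℕ j' →
             ∃ λ v → IsLast (E (lookup C j)) v × IsFirst (E (lookup C j')) v
                   × Inδ (i ∸ k ℕ.+ suc (toℕ j)) (σ v)
                   × (∀ u → u ∈ E (lookup C j) → ¬ (u ≡ v) →
                        col u ≡ i ∸ k ℕ.+ suc (toℕ j)))
        × (∀ (j : Fin k) → toℕ j ≡ 0 →
             ∃ λ v → IsFirst (E (lookup C j)) v × InΔ (i ∸ k ℕ.+ 1) (σ v))

  IsSomeChain : (k : ℕ) → Vec (Fin e) k → Set
  IsSomeChain k C = ∃ λ (σ : Fin m → R) → Weights σ ×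
    ∃ λ (col : Fin m → ℕ) → IsAlg1 σ col ×
    ∃ λ i → (k ℕ.≤ i) × (i ℕ.≤ r) × IsChain σ col k i C

  -- the hypotheses on n, r, m, H (all in ℝ, rearranged multiplicatively):
  --   2 ≤ r < (ln n)^{1/5}            ⇔  r^5 < ln n
  --   r ∣ m
  --   m ≥ n²(r-1)/(2 ln n)            ⇔  n²(r-1) ≤ 2m · ln n
  --   |E| ≤ 0.01 (n/ln n)^{(r-1)/r} r^{n-1}
  --        ⇔  (100|E|)^r (ln n)^{r-1} ≤ n^{r-1} r^{r(n-1)}
  --   H is n-uniform, edges distinct
  Hypotheses : Set
  Hypotheses =
      (2 ℕ.≤ r)
    × (fromℕ (r ℕ.^ 5) <ʳ ln (fromℕ n))
    × (r Data.Nat.Divisibility.∣ m)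
    × (fromℕ (n ℕ.* n ℕ.* (r ∸ 1)) ≤ʳ fromℕ (2 ℕ.* m) *ʳ ln (fromℕ n))
    × (fromℕ ((100 ℕ.* e) ℕ.^ r) *ʳ (ln (fromℕ n) ^ʳ (r ∸ 1))
         ≤ʳ fromℕ ((n ℕ.^ (r ∸ 1)) ℕ.* (r ℕ.^ (r ℕ.* (n ∸ 1)))))
    × (∀ j → Data.Fin.Subset.∣ E j ∣ ≡ n)
    × (∀ j j' → E j ≡ E j' → j ≡ j')
    where import Data.Nat.Divisibility
          import Data.Fin.Subset

-- An ordered chain (C₁,…,C_k) is an induced path in the intersection graph of the
-- edges: C_j and C_{j+1} share their link vertex, while every vertex of C_j has
-- colour i-k+j or i-k+j+1 in C⁰, so edges two or more steps apart are disjoint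
-- and no edge occurs twice (C_j has a vertex of colour i-k+j, all of C_{j+1}
-- have larger colours). The positions of the edges of an induced path are
-- determined by its set of edges up to reversal, hence a chain is determined by
-- its k-set of edges together with one bit recording whether its first edge
-- precedes its last edge, which leaves at most 2·binom(|E|,k) chains.

module Submission where

open import Defs
open import Data.Bool using (Bool; true; false; T)
open import Data.Empty using (⊥-elim)
open import Data.Fin using (Fin; zero; suc; toℕ; fromℕ; fromℕ<; opposite)
open import Data.Fin.Properties as Finₚ
  using (toℕ-injective; toℕ<n; toℕ-fromℕ<; fromℕ<-toℕ; opposite-prop; opposite-involutive; any?; injective⇒≤)
  renaming (_≟_ to _≟ᶠ_)
open import Data.Fin.Subset using (Subset; inside; outside; _∈_; _∉_; _⊆_; ∣_∣; ⁅_⁆; _∪_)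
  renaming (⊥ to ∅)
open import Data.Fin.Subset.Properties
  using (_∈?_; ∉⊥; x∈⁅x⁆; x∈⁅y⁆⇒x≡y; x∈p∪q⁺; x∈p∪q⁻; ∪-identityˡ; ∣⊥∣≡0; ∣⁅x⁆∣≡1; p⊆q⇒∣p∣≤∣q∣)
open import Data.List as List using (List; []; _∷_; [_]; length; map; _++_)
open import Data.List.Properties using (length-map; length-++)
open import Data.List.Membership.Propositional using () renaming (_∈_ to _∈ˡ_)
open import Data.List.Membership.Propositional.Properties using (∈-map⁺; ∈-++⁺ˡ; ∈-++⁺ʳ; ∈-lookup)
open import Data.List.Relation.Unary.All as All using (All)
open import Data.List.Relation.Unary.AllPairs using (_∷_)
open import Data.List.Relation.Unary.Any using (here; index)
open import Data.List.Relation.Unary.Any.Properties using (lookup-index)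
open import Data.List.Relation.Unary.Unique.Propositional using (Unique)
open import Data.Nat using (ℕ; zero; suc; _+_; _*_; _∸_; _≤_; _<_; _<ᵇ_; z≤n; s≤s; s≤s⁻¹; z<s; s<s)
open import Data.Nat.Combinatorics using (_C_; nCk+nC[k+1]≡[n+1]C[k+1])
open import Data.Nat.Properties
open import Data.Product using (∃; _×_; _,_; proj₁; proj₂)
open import Data.Sum as Sum using (_⊎_; inj₁; inj₂; [_,_]′)
open import Data.Vec as Vec using (Vec; []; _∷_; lookup; tabulate; here; there)
open import Data.Vec.Properties using (tabulate∘lookup; tabulate-cong)
open import Function using (_∘_)
open import Function.Definitions using (Injective)
open import Relation.Binary.Definitions using (tri<; tri≈; tri>)
open import Relation.Binary.PropositionalEquality
  using (_≡_; _≢_; refl; sym; trans; cong; cong₂; subst; subst₂; module ≡-Reasoning)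
open import Relation.Nullary using (¬_; yes; no; contradiction; ¬?)
open import Relation.Nullary.Decidable using (_×-dec_; ¬¬-excluded-middle)
open import Relation.Nullary.Negation using (¬¬-map)

unique⇒lookup-injective : ∀ {A : Set} {xs : List A} → Unique xs → Injective _≡_ _≡_ (List.lookup xs)
unique⇒lookup-injective {xs = _ ∷ _} (_ ∷ _) {zero} {zero} _ = refl
unique⇒lookup-injective {xs = _ ∷ _} (x∉xs ∷ _) {zero} {suc j} eq =
  ⊥-elim (All.lookup x∉xs (∈-lookup j) eq)
unique⇒lookup-injective {xs = _ ∷ _} (x∉xs ∷ _) {suc i} {zero} eq =
  ⊥-elim (All.lookup x∉xs (∈-lookup i) (sym eq))
unique⇒lookup-injective {xs = _ ∷ _} (_ ∷ unique) {suc i} {suc j} eq =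
  cong suc (unique⇒lookup-injective unique eq)

module _ {A B : Set} {P : A → Set} (f : A → B)
         (f-injective : ∀ {x y} → P x → P y → f x ≡ f y → x ≡ y)
         {ys : List B} (f∈ys : ∀ {x} → P x → f x ∈ˡ ys) where

  unique-length-≤ : ∀ {xs} → Unique xs → All P xs → length xs ≤ length ys
  unique-length-≤ {xs} unique Pxs = injective⇒≤ position-injective
    where
    P-at : ∀ i → P (List.lookup xs i)
    P-at i = All.lookup Pxs (∈-lookup i)

    position : Fin (length xs) → Fin (length ys)
    position i = index (f∈ys (P-at i))

    position-injective : Injective _≡_ _≡_ position
    position-injective {i} {j} eq = unique⇒lookup-injective unique (f-injective (P-at i) (P-at j) (begin
      f (List.lookup xs i)         ≡⟨ lookup-index (f∈ys (P-at i)) ⟩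
      List.lookup ys (position i)  ≡⟨ cong (List.lookup ys) eq ⟩
      List.lookup ys (position j)  ≡⟨ lookup-index (f∈ys (P-at j)) ⟨
      f (List.lookup xs j)         ∎))
      where open ≡-Reasoning

subsetsOfSize : ∀ n → ℕ → List (Subset n)
subsetsOfSize _       zero    = [ ∅ ]
subsetsOfSize zero    (suc k) = []
subsetsOfSize (suc n) (suc k) =
  map (inside Vec.∷_) (subsetsOfSize n k) ++ map (outside Vec.∷_) (subsetsOfSize n (suc k))

length-subsetsOfSize : ∀ n k → length (subsetsOfSize n k) ≡ n C k
length-subsetsOfSize _       zero    = refl
length-subsetsOfSize zero    (suc k) = refl
length-subsetsOfSize (suc n) (suc k) = begin
  length (map (inside Vec.∷_) with-n ++ map (outside Vec.∷_) without-n)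
    ≡⟨ length-++ (map (inside Vec.∷_) with-n) ⟩
  length (map (inside Vec.∷_) with-n) + length (map (outside Vec.∷_) without-n)
    ≡⟨ cong₂ _+_ (trans (length-map _ with-n) (length-subsetsOfSize n k))
                 (trans (length-map _ without-n) (length-subsetsOfSize n (suc k))) ⟩
  n C k + n C suc k
    ≡⟨ nCk+nC[k+1]≡[n+1]C[k+1] n k ⟩
  suc n C suc k ∎
  where
  open ≡-Reasoning
  with-n = subsetsOfSize n k
  without-n = subsetsOfSize n (suc k)

∈-subsetsOfSize : ∀ {n} (p : Subset n) → p ∈ˡ subsetsOfSize n ∣ p ∣
∈-subsetsOfSize []            = here refl
∈-subsetsOfSize (inside ∷ p)  = ∈-++⁺ˡ (∈-map⁺ (inside Vec.∷_) (∈-subsetsOfSize p))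
∈-subsetsOfSize (outside ∷ p) with ∣ p ∣ | ∈-subsetsOfSize p
... | zero  | here p≡∅ = here (cong (outside Vec.∷_) p≡∅)
... | suc _ | p∈      = ∈-++⁺ʳ _ (∈-map⁺ (outside Vec.∷_) p∈)

∃-∈-≢ : ∀ {n} {p : Subset n} → 2 ≤ ∣ p ∣ → ∀ v → ∃ λ u → u ∈ p × u ≢ v
∃-∈-≢ {p = p} 2≤∣p∣ v with any? (λ u → u ∈? p ×-dec ¬? (u ≟ᶠ v))
... | yes found = found
... | no none = contradiction (subst (∣ p ∣ ≤_) (∣⁅x⁆∣≡1 v) (p⊆q⇒∣p∣≤∣q∣ p⊆⁅v⁆)) (<⇒≱ 2≤∣p∣)
  where
  p⊆⁅v⁆ : p ⊆ ⁅ v ⁆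
  p⊆⁅v⁆ {u} u∈p with u ≟ᶠ v
  ... | yes refl = x∈⁅x⁆ v
  ... | no u≢v   = contradiction (u , u∈p , u≢v) none

∣⁅x⁆∪p∣ : ∀ {n} x (p : Subset n) → x ∉ p → ∣ ⁅ x ⁆ ∪ p ∣ ≡ suc ∣ p ∣
∣⁅x⁆∪p∣ zero    (outside ∷ p) _   = cong (suc ∘ ∣_∣) (∪-identityˡ p)
∣⁅x⁆∪p∣ zero    (inside ∷ p)  x∉p = contradiction here x∉p
∣⁅x⁆∪p∣ (suc x) (outside ∷ p) x∉p = ∣⁅x⁆∪p∣ x p (x∉p ∘ there)
∣⁅x⁆∪p∣ (suc x) (inside ∷ p)  x∉p = cong suc (∣⁅x⁆∪p∣ x p (x∉p ∘ there))

tagged : ∀ {A : Set} → List A → List (A × Bool)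
tagged xs = map (_, true) xs ++ map (_, false) xs

length-tagged : ∀ {A : Set} (xs : List A) → length (tagged xs) ≡ 2 * length xs
length-tagged xs = begin
  length (map (_, true) xs ++ map (_, false) xs)          ≡⟨ length-++ (map (_, true) xs) ⟩
  length (map (_, true) xs) + length (map (_, false) xs)  ≡⟨ cong₂ _+_ (length-map _ xs) (length-map _ xs) ⟩
  length xs + length xs                                   ≡⟨ cong (length xs +_) (+-identityʳ _) ⟨
  2 * length xs                                           ∎
  where open ≡-Reasoning

∈-tagged : ∀ {A : Set} {x : A} {xs} → x ∈ˡ xs → ∀ b → (x , b) ∈ˡ tagged xs
∈-tagged x∈xs true  = ∈-++⁺ˡ (∈-map⁺ (_, true) x∈xs)
∈-tagged x∈xs false = ∈-++⁺ʳ _ (∈-map⁺ (_, false) x∈xs)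

lookup-extensionality : ∀ {A : Set} {n} (xs ys : Vec A n) → (∀ i → lookup xs i ≡ lookup ys i) → xs ≡ ys
lookup-extensionality xs ys eq = begin
  xs                  ≡⟨ tabulate∘lookup xs ⟨
  tabulate (lookup xs) ≡⟨ tabulate-cong eq ⟩
  tabulate (lookup ys) ≡⟨ tabulate∘lookup ys ⟩
  ys                  ∎
  where open ≡-Reasoning

entrySet : ∀ {e k} → Vec (Fin e) k → Subset e
entrySet []       = ∅
entrySet (x ∷ xs) = ⁅ x ⁆ ∪ entrySet xs

∈-entrySet⁺ : ∀ {e k} (W : Vec (Fin e) k) a → lookup W a ∈ entrySet W
∈-entrySet⁺ (x ∷ W) zero    = x∈p∪q⁺ (inj₁ (x∈⁅x⁆ x))
∈-entrySet⁺ (x ∷ W) (suc a) = x∈p∪q⁺ (inj₂ (∈-entrySet⁺ W a))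

∈-entrySet⁻ : ∀ {e k} (W : Vec (Fin e) k) {y} → y ∈ entrySet W → ∃ λ a → lookup W a ≡ y
∈-entrySet⁻ []      y∈∅ = contradiction y∈∅ ∉⊥
∈-entrySet⁻ (x ∷ W) y∈  with x∈p∪q⁻ ⁅ x ⁆ (entrySet W) y∈
... | inj₁ y∈⁅x⁆ = zero , sym (x∈⁅y⁆⇒x≡y x y∈⁅x⁆)
... | inj₂ y∈W   = let a , eq = ∈-entrySet⁻ W y∈W in suc a , eq

∣entrySet∣ : ∀ {e k} (W : Vec (Fin e) k) → Injective _≡_ _≡_ (lookup W) → ∣ entrySet W ∣ ≡ k
∣entrySet∣ {e} []      _        = ∣⊥∣≡0 e
∣entrySet∣ (x ∷ W) distinct =
  trans (∣⁅x⁆∪p∣ x (entrySet W) x∉W) (cong suc (∣entrySet∣ W (Finₚ.suc-injective ∘ distinct)))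
  where
  x∉W : x ∉ entrySet W
  x∉W x∈W = let a , eq = ∈-entrySet⁻ W x∈W in contradiction (distinct {zero} {suc a} (sym eq)) λ ()

module _ (G : ℕ → ℕ) (K : ℕ)
         (unit-step : ∀ j → suc j < K → suc (G j) ≡ G (suc j) ⊎ G j ≡ suc (G (suc j)))
         (no-return : ∀ j → suc (suc j) < K → G (suc (suc j)) ≢ G j) where

  private
    Ascends Descends : ℕ → Set
    Ascends j = suc (G j) ≡ G (suc j)
    Descends j = G j ≡ suc (G (suc j))

    ascends-persists : ∀ j → suc (suc j) < K → Ascends j → Ascends (suc j)
    ascends-persists j lt up with unit-step (suc j) lt
    ... | inj₁ up′ = up′
    ... | inj₂ down = ⊥-elim (no-return j lt (sym (suc-injective (trans up down))))

    descends-persists : ∀ j → suc (suc j) < K → Descends j → Descends (suc j)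
    descends-persists j lt down with unit-step (suc j) lt
    ... | inj₁ up    = ⊥-elim (no-return j lt (sym (trans down up)))
    ... | inj₂ down′ = down′

    persists : (D : ℕ → Set) → (∀ j → suc (suc j) < K → D j → D (suc j)) →
               D 0 → ∀ j → suc j < K → D j
    persists D step D0 zero    _  = D0
    persists D step D0 (suc j) lt = step j lt (persists D step D0 j (<⇒≤ lt))

    ascending : (∀ j → suc j < K → Ascends j) → ∀ j → j < K → G j ≡ G 0 + j
    ascending up zero    _  = sym (+-identityʳ (G 0))
    ascending up (suc j) lt = begin
      G (suc j)     ≡⟨ up j lt ⟨
      suc (G j)     ≡⟨ cong suc (ascending up j (<⇒≤ lt)) ⟩
      suc (G 0 + j) ≡⟨ +-suc (G 0) j ⟨
      G 0 + suc j   ∎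
      where open ≡-Reasoning

    descending : (∀ j → suc j < K → Descends j) → ∀ j → j < K → G j + j ≡ G 0
    descending down zero    _  = +-identityʳ (G 0)
    descending down (suc j) lt = begin
      G (suc j) + suc j   ≡⟨ +-suc (G (suc j)) j ⟩
      suc (G (suc j)) + j ≡⟨ cong (_+ j) (down j lt) ⟨
      G j + j             ≡⟨ descending down j (<⇒≤ lt) ⟩
      G 0                 ∎
      where open ≡-Reasoning

  unit-steps⇒monotone : (∀ j → j < K → G j ≡ G 0 + j) ⊎ (∀ j → j < K → G j + j ≡ G 0)
  unit-steps⇒monotone with 1 <? K
  ... | yes 1<K = [ inj₁ ∘ ascending ∘ persists Ascends ascends-persists
                  , inj₂ ∘ descending ∘ persists Descends descends-persists
                  ]′ (unit-step 0 1<K)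
  ... | no 1≮K  = inj₁ (ascending λ j 1+j<K → contradiction (≤-trans (s<s z<s) 1+j<K) 1≮K)

unit-step-permutation : ∀ {k} (g : Fin (suc k) → Fin (suc k)) → Injective _≡_ _≡_ g →
  (∀ a b → suc (toℕ a) ≡ toℕ b → suc (toℕ (g a)) ≡ toℕ (g b) ⊎ toℕ (g a) ≡ suc (toℕ (g b))) →
  (∀ a → g a ≡ a) ⊎ (∀ a → g a ≡ opposite a)
unit-step-permutation {k} g g-injective g-unit-step =
  Sum.map identity reversal (unit-steps⇒monotone G (suc k) G-unit-step G-no-return)
  where
  open ≡-Reasoning

  G : ℕ → ℕ
  G j with j <? suc k
  ... | yes j<K = toℕ (g (fromℕ< j<K))
  ... | no  _   = 0

  G-bounded : ∀ j → G j < suc k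
  G-bounded j with j <? suc k
  ... | yes _ = toℕ<n _
  ... | no  _ = z<s

  G-toℕ : ∀ a → G (toℕ a) ≡ toℕ (g a)
  G-toℕ a with toℕ a <? suc k
  ... | yes a<K = cong (toℕ ∘ g) (fromℕ<-toℕ a a<K)
  ... | no  a≮K = contradiction (toℕ<n a) a≮K

  G-fromℕ< : ∀ {j} (j<K : j < suc k) → G j ≡ toℕ (g (fromℕ< j<K))
  G-fromℕ< j<K = trans (cong G (sym (toℕ-fromℕ< j<K))) (G-toℕ (fromℕ< j<K))

  G-unit-step : ∀ j → suc j < suc k → suc (G j) ≡ G (suc j) ⊎ G j ≡ suc (G (suc j))
  G-unit-step j 1+j<K =
    subst₂ (λ x y → suc x ≡ y ⊎ x ≡ suc y) (sym (G-fromℕ< (<⇒≤ 1+j<K))) (sym (G-fromℕ< 1+j<K))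
      (g-unit-step _ _ (trans (cong suc (toℕ-fromℕ< _)) (sym (toℕ-fromℕ< 1+j<K))))

  G-no-return : ∀ j → suc (suc j) < suc k → G (suc (suc j)) ≢ G j
  G-no-return j 2+j<K eq = <⇒≢ j<2+j (sym (begin
    suc (suc j)               ≡⟨ toℕ-fromℕ< 2+j<K ⟨
    toℕ (fromℕ< 2+j<K)        ≡⟨ cong toℕ (g-injective (toℕ-injective same-value)) ⟩
    toℕ (fromℕ< j<K)          ≡⟨ toℕ-fromℕ< j<K ⟩
    j                         ∎))
    where
    j<2+j : j < suc (suc j)
    j<2+j = <-trans (n<1+n j) (n<1+n (suc j))
    j<K : j < suc k
    j<K = <-trans j<2+j 2+j<K
    same-value : toℕ (g (fromℕ< 2+j<K)) ≡ toℕ (g (fromℕ< j<K))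
    same-value = trans (sym (G-fromℕ< 2+j<K)) (trans eq (G-fromℕ< j<K))

  identity : (∀ j → j < suc k → G j ≡ G 0 + j) → ∀ a → g a ≡ a
  identity ascending a = toℕ-injective (begin
    toℕ (g a)   ≡⟨ G-toℕ a ⟨
    G (toℕ a)   ≡⟨ ascending (toℕ a) (toℕ<n a) ⟩
    G 0 + toℕ a ≡⟨ cong (_+ toℕ a) G0≡0 ⟩
    toℕ a       ∎)
    where
    G0≡0 : G 0 ≡ 0
    G0≡0 = n≤0⇒n≡0 (+-cancelʳ-≤ k (G 0) 0
             (s≤s⁻¹ (subst (_< suc k) (ascending k ≤-refl) (G-bounded k))))

  reversal : (∀ j → j < suc k → G j + j ≡ G 0) → ∀ a → g a ≡ opposite a
  reversal descending a = toℕ-injective (begin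
    toℕ (g a)                 ≡⟨ m+n∸n≡m (toℕ (g a)) (toℕ a) ⟨
    toℕ (g a) + toℕ a ∸ toℕ a ≡⟨ cong (λ x → x + toℕ a ∸ toℕ a) (G-toℕ a) ⟨
    G (toℕ a) + toℕ a ∸ toℕ a ≡⟨ cong (_∸ toℕ a) (descending (toℕ a) (toℕ<n a)) ⟩
    G 0 ∸ toℕ a               ≡⟨ cong (_∸ toℕ a) G0≡k ⟩
    k ∸ toℕ a                 ≡⟨ opposite-prop a ⟨
    toℕ (opposite a)          ∎)
    where
    G0≡k : G 0 ≡ k
    G0≡k = ≤-antisym (s≤s⁻¹ (G-bounded 0)) (subst (k ≤_) (descending k ≤-refl) (m≤n+m k (G k)))

record IsInducedPath {m e k} (E : Fin e → Subset m) (W : Vec (Fin e) k) : Set where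
  field
    distinct         : Injective _≡_ _≡_ (lookup W)
    consecutive-meet : ∀ a b → suc (toℕ a) ≡ toℕ b →
                       ∃ λ u → u ∈ E (lookup W a) × u ∈ E (lookup W b)
    distant-disjoint : ∀ a b → suc (toℕ a) < toℕ b →
                       ∀ {u} → u ∈ E (lookup W a) → u ∉ E (lookup W b)

  meet⇒adjacent : ∀ {a b u} → a ≢ b → u ∈ E (lookup W a) → u ∈ E (lookup W b) →
                  suc (toℕ a) ≡ toℕ b ⊎ toℕ a ≡ suc (toℕ b)
  meet⇒adjacent {a} {b} a≢b u∈a u∈b with <-cmp (toℕ a) (toℕ b)
  ... | tri≈ _ a≡b _ = contradiction (toℕ-injective a≡b) a≢b
  ... | tri< a<b _ _ =
    [ (λ far → contradiction u∈b (distant-disjoint a b far u∈a)) , inj₁ ]′ (m≤n⇒m<n∨m≡n a<b)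
  ... | tri> _ _ b<a =
    [ (λ far → contradiction u∈a (distant-disjoint b a far u∈b)) , inj₂ ∘ sym ]′ (m≤n⇒m<n∨m≡n b<a)

open IsInducedPath

module _ {m e k} {E : Fin e → Subset m} {W₁ W₂ : Vec (Fin e) (suc k)}
         (path₁ : IsInducedPath E W₁) (path₂ : IsInducedPath E W₂)
         (same-entries : entrySet W₁ ≡ entrySet W₂) where

  private
    position : Fin (suc k) → Fin (suc k)
    position a = proj₁ (∈-entrySet⁻ W₂ (subst (lookup W₁ a ∈_) same-entries (∈-entrySet⁺ W₁ a)))

    lookup-position : ∀ a → lookup W₂ (position a) ≡ lookup W₁ a
    lookup-position a = proj₂ (∈-entrySet⁻ W₂ (subst (lookup W₁ a ∈_) same-entries (∈-entrySet⁺ W₁ a)))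

    position-injective : Injective _≡_ _≡_ position
    position-injective {a} {b} eq =
      distinct path₁ (trans (sym (lookup-position a)) (trans (cong (lookup W₂) eq) (lookup-position b)))

    in-position : ∀ {a u} → u ∈ E (lookup W₁ a) → u ∈ E (lookup W₂ (position a))
    in-position {a} {u} = subst (λ c → u ∈ E c) (sym (lookup-position a))

    position-unit-step : ∀ a b → suc (toℕ a) ≡ toℕ b →
      suc (toℕ (position a)) ≡ toℕ (position b) ⊎ toℕ (position a) ≡ suc (toℕ (position b))
    position-unit-step a b a⋯b =
      let u , u∈a , u∈b = consecutive-meet path₁ a b a⋯b
      in meet⇒adjacent path₂ (a≢b ∘ position-injective) (in-position u∈a) (in-position u∈b)
      where
      a≢b : a ≢ b
      a≢b refl = 1+n≢n a⋯b

  same-entries⇒equal-or-reversed : W₂ ≡ W₁ ⊎ (∀ a → lookup W₂ (opposite a) ≡ lookup W₁ a)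
  same-entries⇒equal-or-reversed =
    Sum.map (λ fixed → lookup-extensionality W₂ W₁ λ a →
               trans (cong (lookup W₂) (sym (fixed a))) (lookup-position a))
            (λ reversed a → trans (cong (lookup W₂) (sym (reversed a))) (lookup-position a))
            (unit-step-permutation position position-injective position-unit-step)

isAscending : ∀ {e k} → Vec (Fin e) (suc k) → Bool
isAscending {k = k} W = toℕ (lookup W zero) <ᵇ toℕ (lookup W (fromℕ k))

<ᵇ-swap-≡⇒≡ : ∀ m n → (m <ᵇ n) ≡ (n <ᵇ m) → m ≡ n
<ᵇ-swap-≡⇒≡ m n eq with <-cmp m n
... | tri< m<n _ _ = contradiction (<ᵇ⇒< n m (subst T eq (<⇒<ᵇ m<n))) (<⇒≯ m<n)
... | tri≈ _ m≡n _ = m≡n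
... | tri> _ _ n<m = contradiction (<ᵇ⇒< m n (subst T (sym eq) (<⇒<ᵇ n<m))) (<⇒≯ n<m)

induced-path-determined : ∀ {m e k} {E : Fin e → Subset m} {W₁ W₂ : Vec (Fin e) (suc k)} →
  IsInducedPath E W₁ → IsInducedPath E W₂ →
  entrySet W₁ ≡ entrySet W₂ → isAscending W₁ ≡ isAscending W₂ → W₁ ≡ W₂
induced-path-determined path₁ path₂ same _ with same-entries⇒equal-or-reversed path₁ path₂ same
... | inj₁ W₂≡W₁ = sym W₂≡W₁
induced-path-determined {k = zero} {W₁ = W₁} {W₂} _ _ _ _ | inj₂ reversed =
  lookup-extensionality W₁ W₂ λ { zero → sym (reversed zero) }
induced-path-determined {k = suc k} {W₁ = W₁} {W₂} path₁ _ _ same-orientation | inj₂ reversed =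
  contradiction (distinct path₁ (toℕ-injective first≡last)) λ ()
  where
  first₂ : lookup W₂ zero ≡ lookup W₁ (fromℕ (suc k))
  first₂ = trans (cong (lookup W₂) (sym (opposite-involutive zero))) (reversed (fromℕ (suc k)))

  first≡last : toℕ (lookup W₁ zero) ≡ toℕ (lookup W₁ (fromℕ (suc k)))
  first≡last = <ᵇ-swap-≡⇒≡ _ _ (trans same-orientation
                 (cong₂ (λ x y → toℕ x <ᵇ toℕ y) first₂ (reversed zero)))

induced-paths-counted : ∀ {m e k} (E : Fin e → Subset m) {P : Vec (Fin e) (suc k) → Set} →
  (∀ {W} → P W → IsInducedPath E W) →
  ∀ {L} → Unique L → All P L → length L ≤ 2 * (e C suc k)
induced-paths-counted {e = e} {k} E {P} path {L} unique all-P = begin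
  length L                                  ≤⟨ unique-length-≤ encode encode-injective encode-∈ unique all-P ⟩
  length (tagged (subsetsOfSize e (suc k))) ≡⟨ length-tagged (subsetsOfSize e (suc k)) ⟩
  2 * length (subsetsOfSize e (suc k))      ≡⟨ cong (2 *_) (length-subsetsOfSize e (suc k)) ⟩
  2 * (e C suc k)                           ∎
  where
  open ≤-Reasoning

  encode : Vec (Fin e) (suc k) → Subset e × Bool
  encode W = entrySet W , isAscending W

  encode-injective : ∀ {W V} → P W → P V → encode W ≡ encode V → W ≡ V
  encode-injective PW PV eq = induced-path-determined (path PW) (path PV) (cong proj₁ eq) (cong proj₂ eq)

  encode-∈ : ∀ {W} → P W → encode W ∈ˡ tagged (subsetsOfSize e (suc k))
  encode-∈ {W} PW = ∈-tagged (subst (λ s → entrySet W ∈ˡ subsetsOfSize e s)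
                                     (∣entrySet∣ W (distinct (path PW))) (∈-subsetsOfSize (entrySet W)))
                             (isAscending W)

module _ (ℝ : Reals) (n r : ℕ) {m e : ℕ} (E : Fin e → Subset m)
         (two-vertices : ∀ j → 2 ≤ ∣ E j ∣) where
  open Setting ℝ n r E

  module _ {σ : Fin m → Reals.R ℝ} {col : Fin m → ℕ} (alg : IsAlg1 σ col)
           {k i : ℕ} (k≤i : k ≤ i) (i≤r : i ≤ r) {W : Vec (Fin e) k}
           (chain : IsChain σ col k i W) where

    -- the colour i-k+j of the edge C_j at position a = j-1
    level : Fin k → ℕ
    level a = i ∸ k + suc (toℕ a)

    last-colour : ∀ a → suc (toℕ a) ≡ k → ∀ u → u ∈ E (lookup W a) → col u ≡ i
    last-colour = proj₁ chain

    links : ∀ a b → suc (toℕ a) ≡ toℕ b →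
      ∃ λ v → IsLast σ (E (lookup W a)) v × IsFirst σ (E (lookup W b)) v × Inδ (level a) (σ v)
            × (∀ u → u ∈ E (lookup W a) → u ≢ v → col u ≡ level a)
    links = proj₁ (proj₂ chain)

    level-< : ∀ {a b} → toℕ a < toℕ b → level a < level b
    level-< a<b = +-monoʳ-< (i ∸ k) (s<s a<b)

    level-gap : ∀ {a b} → suc (toℕ a) < toℕ b → suc (level a) < level b
    level-gap {a} {b} gap = subst (_< level b) (+-suc (i ∸ k) (suc (toℕ a))) (+-monoʳ-< (i ∸ k) (s<s gap))

    level-last : ∀ {a} → suc (toℕ a) ≡ k → level a ≡ i
    level-last a-last = trans (cong (i ∸ k +_) a-last) (m∸n+n≡m k≤i)

    1≤level : ∀ a → 1 ≤ level a
    1≤level a = ≤-trans (s≤s z≤n) (m≤n+m (suc (toℕ a)) (i ∸ k))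

    level≤r∸1 : ∀ {a} → suc (toℕ a) < k → level a ≤ r ∸ 1
    level≤r∸1 {a} a+1<k = ∸-monoˡ-≤ 1 (begin
      suc (level a)              ≡⟨ +-suc (i ∸ k) (suc (toℕ a)) ⟨
      i ∸ k + suc (suc (toℕ a))  ≤⟨ +-monoʳ-≤ (i ∸ k) a+1<k ⟩
      i ∸ k + k                  ≡⟨ m∸n+n≡m k≤i ⟩
      i                          ≤⟨ i≤r ⟩
      r                          ∎)
      where open ≤-Reasoning

    colour-level-or-next : ∀ a {u} → u ∈ E (lookup W a) → ¬ ¬ (col u ≡ level a ⊎ col u ≡ suc (level a))
    colour-level-or-next a {u} u∈a with suc (toℕ a) ≟ k
    ... | yes a-last = λ ¬colour → ¬colour (inj₁ (trans (last-colour a a-last u u∈a) (sym (level-last a-last))))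
    ... | no ¬a-last with links a (fromℕ< (≤∧≢⇒< (toℕ<n a) ¬a-last)) (sym (toℕ-fromℕ< _))
    ...   | v , _ , _ , v∈δ , others with u ≟ᶠ v
    ...     | no u≢v   = λ ¬colour → ¬colour (inj₁ (others u u∈a u≢v))
    ...     | yes refl = ¬¬-map (λ { (yes blocked) → inj₂ (proj₁ δ-rule blocked)
                                   ; (no free)     → inj₁ (proj₂ δ-rule free) })
                                ¬¬-excluded-middle
      where
      δ-rule : (Blocked σ col (level a) u → col u ≡ suc (level a)) × (¬ Blocked σ col (level a) u → col u ≡ level a)
      δ-rule = proj₂ (alg u) (level a) (1≤level a) (level≤r∸1 (≤∧≢⇒< (toℕ<n a) ¬a-last)) v∈δ

    colour-near-level : ∀ a {u} → u ∈ E (lookup W a) → ¬ ¬ (level a ≤ col u × col u ≤ suc (level a))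
    colour-near-level a u∈a = ¬¬-map near (colour-level-or-next a u∈a)
      where
      near : ∀ {c l} → c ≡ l ⊎ c ≡ suc l → l ≤ c × c ≤ suc l
      near (inj₁ refl) = ≤-refl , n≤1+n _
      near (inj₂ refl) = n≤1+n _ , ≤-refl

    vertex-of-level : ∀ {a} → suc (toℕ a) < k → ∃ λ u → u ∈ E (lookup W a) × col u ≡ level a
    vertex-of-level {a} a+1<k with links a (fromℕ< a+1<k) (sym (toℕ-fromℕ< a+1<k))
    ... | v , _ , _ , _ , others =
      let u , u∈a , u≢v = ∃-∈-≢ (two-vertices (lookup W a)) v in u , u∈a , others u u∈a u≢v

    earlier-edge-not-repeated : ∀ {a b} → toℕ a < toℕ b → lookup W a ≢ lookup W b
    earlier-edge-not-repeated {a} {b} a<b same =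
      let u , u∈a , colour≡level = vertex-of-level (≤-trans (s≤s a<b) (toℕ<n b))
      in colour-near-level b (subst (λ c → u ∈ E c) same u∈a) λ (level≤colour , _) →
           <⇒≱ (level-< a<b) (subst (level b ≤_) colour≡level level≤colour)

    chain-distinct : Injective _≡_ _≡_ (lookup W)
    chain-distinct {a} {b} same with <-cmp (toℕ a) (toℕ b)
    ... | tri< a<b _ _ = contradiction same (earlier-edge-not-repeated a<b)
    ... | tri≈ _ a≡b _ = toℕ-injective a≡b
    ... | tri> _ _ b<a = contradiction (sym same) (earlier-edge-not-repeated b<a)

    chain-isInducedPath : IsInducedPath E W
    chain-isInducedPath = record
      { distinct         = chain-distinct
      ; consecutive-meet = λ a b a⋯b → let v , (v∈a , _) , (v∈b , _) , _ = links a b a⋯b in v , v∈a , v∈b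
      ; distant-disjoint = λ a b gap u∈a u∈b →
          colour-near-level a u∈a λ (_ , colour≤level+1) →
          colour-near-level b u∈b λ (level≤colour , _) →
          <⇒≱ (level-gap gap) (≤-trans level≤colour colour≤level+1)
      }

  chain⇒induced-path : ∀ {k W} → IsSomeChain k W → IsInducedPath E W
  chain⇒induced-path (_ , _ , _ , alg , _ , k≤i , i≤r , chain) = chain-isInducedPath alg k≤i i≤r chain

lemma1 : (ℝ : Reals) → ∃ λ (N : ℕ) → ∀ n → N ≤ n → ∀ r m e (E : Fin e → Subset m) →
    Setting.Hypotheses ℝ n r E →
    ∀ k → 1 ≤ k → (L : List (Vec (Fin e) k)) → Unique L →
    All (Setting.IsSomeChain ℝ n r E k) L → length L ≤ 2 * (e C k)
lemma1 ℝ = 2 , counted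
  where
  counted : ∀ n → 2 ≤ n → ∀ r m e (E : Fin e → Subset m) →
    Setting.Hypotheses ℝ n r E →
    ∀ k → 1 ≤ k → (L : List (Vec (Fin e) k)) → Unique L →
    All (Setting.IsSomeChain ℝ n r E k) L → length L ≤ 2 * (e C k)
  counted n 2≤n r m e E (_ , _ , _ , _ , _ , uniform , _) (suc k) _ _ unique chains =
    induced-paths-counted E (chain⇒induced-path ℝ n r E two-vertices) unique chains
    where
    two-vertices : ∀ j → 2 ≤ ∣ E j ∣
    two-vertices j = subst (2 ≤_) (sym (uniform j)) 2≤n
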